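{- For every positive integer $k$ and every integer $n\ge 3$, $$\mathcal{G}\left(T_{\{n\}} \stackrel{k}{\cdot - \cdot}\right)=\mathcal{G}\left(T_{\{n-2\}} \stackrel{k}{\cdot - \cdot}\right).$$
   Context: Node-Kayles is the impartial game on a finite simple graph $G$ in which a move chooses a vertex $v$ and deletes its closed neighbourhood $N_G[v]=\{v\}\cup N_G(v)$; a player with no move loses. The Grundy value is defined by $\mathcal{G}(\emptyset)=0$ and $\mathcal{G}(G)=\mathrm{mex}\{\mathcal{G}(G\setminus N_G[v]) : v\in V(G)\}$, with $\mathrm{mex}(S)$ the least nonnegative integer not in $S$. For a positive integer $n$, $T_{\{n\}}$ is the star $K_{1,n}$ rooted at its center. For $k\ge1$, $T_{\{n\}} \stackrel{k}{\cdot - \cdot}$ denotes the graph obtained from $T_{\{n\}}$ by identifying its root with one endpoint of a path with $k+1$ vertices (i.e. of length $k$); equivalently, the center of the star gets a pendant path of $k$ additional vertices. -}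

module Defs where

open import Data.Nat using (ℕ; zero; suc; _+_; _≡ᵇ_; _≤ᵇ_)
open import Data.Nat.Properties using (_≟_)
open import Data.Bool using (Bool; true; false; _∧_; _∨_; not; if_then_else_)
open import Data.Fin using (Fin; toℕ)
open import Data.List using (List; []; _∷_; length; map)
open import Data.List.Base using (allFin)
open import Data.List.Membership.DecPropositional _≟_ using (_∈?_)
open import Relation.Nullary.Decidable using (does)

-- mex of a finite list of naturals: least m not in the list.
-- Some m ≤ length l is missing, so (length l) search steps suffice.
mexAux : ℕ → ℕ → List ℕ → ℕ
mexAux zero    m l = m
mexAux (suc f) m l = if does (m ∈? l) then mexAux f (suc m) l else m

mex : List ℕ → ℕ
mex l = mexAux (length l) 0 l

Graph : ℕ → Set
Graph N = Fin N → Fin N → Bool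

-- A position: the set of remaining vertices (induced subgraph), as a predicate.
VSet : ℕ → Set
VSet N = Fin N → Bool

deleteN : ∀ {N} → Graph N → VSet N → Fin N → VSet N
deleteN G S v u = S u ∧ not (does (toℕ u ≟ toℕ v)) ∧ not (G v u)

filterB : ∀ {A : Set} → (A → Bool) → List A → List A
filterB p [] = []
filterB p (x ∷ xs) = if p x then x ∷ filterB p xs else filterB p xs

members : ∀ {N} → VSet N → List (Fin N)
members {N} S = filterB S (allFin N)

-- Grundy value of Node-Kayles on the induced subgraph G[S], with fuel.
-- Every move removes at least one vertex, so fuel ≥ |S| gives the true value.
grundyF : ∀ {N} → Graph N → ℕ → VSet N → ℕ
grundyF G zero    S = 0
grundyF G (suc f) S =
  mex (map (λ v → grundyF G f (deleteN G S v)) (members S))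

grundy : ∀ {N} → Graph N → ℕ
grundy {N} G = grundyF G N (λ _ → true)

-- Edge relation of T_{n} with pendant path of length k, on vertices 0 .. n+k:
--   0 = star centre (root), 1..n = leaves, n+1..n+k = the path vertices,
--   path: 0 - (n+1) - (n+2) - ... - (n+k).
dirEdge : ℕ → ℕ → ℕ → Bool
dirEdge n a b =
  ((a ≡ᵇ 0) ∧ (1 ≤ᵇ b) ∧ (b ≤ᵇ suc n)) ∨ ((suc n ≤ᵇ a) ∧ (b ≡ᵇ suc a))

starPath : (n k : ℕ) → Graph (suc (n + k))
starPath n k u v = dirEdge n (toℕ u) (toℕ v) ∨ dirEdge n (toℕ v) (toℕ u)

{-# OPTIONS --safe #-}
-- Let c be the centre of the star and u, w, x three of its leaves. For every position S that
-- contains u and w, and contains x whenever it contains c, deleting u and w does not change the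
-- Grundy value; the proof is by induction on the size of S. If c ∉ S, then u and w are isolated
-- and cancel, as *1 + *1 = 0. If c ∈ S, then S and S ∖ {u, w} have the same option values:
-- every other move commutes with deleting u and w, and the move at u removes c, after which the
-- leaves w and x are isolated and cancel, so it has the value of the move at x from S ∖ {u, w}.
-- Finally, deleting two leaves of T_{n} with its path leaves an induced copy of T_{n-2} with
-- the same path.
module Submission where

open import Defs
open import Algebra.Bundles using (CommutativeMonoid)
open import Data.Bool using (Bool; true; false; _∧_; _∨_; not; T)
open import Data.Bool.Properties
  using (∧-commutativeMonoid; ∧-identityʳ; ∧-zeroʳ; ∧-conicalˡ; ∧-conicalʳ; ∨-comm; T-≡)
open import Data.Empty using (⊥-elim)
open import Data.Fin using (Fin; zero; suc; toℕ)
open import Data.Fin.Properties using (toℕ-injective; toℕ≤pred[n]; pigeonhole) renaming (_≟_ to _≟ᶠ_)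
open import Data.List using (List; []; _∷_; length; map; filterᵇ; lookup; allFin)
open import Data.List.Membership.Propositional using (_∈_; _∉_; lose)
open import Data.List.Membership.Propositional.Properties
  using (∈-allFin; ∈-map⁺; ∈-map⁻; ∈-filter⁺; ∈-filter⁻)
open import Data.List.Properties using (filter-notAll; length-filter; length-tabulate; map-cong-local)
open import Data.List.Relation.Binary.Subset.Propositional using (_⊆_)
import Data.List.Relation.Unary.All as All
open import Data.List.Relation.Unary.Any using (index)
open import Data.List.Relation.Unary.Any.Properties using (lookup-index)
open import Data.Nat using (ℕ; zero; suc; _+_; _∸_; _≤_; _<_; _≡ᵇ_; _<ᵇ_; z≤n; s≤s; s≤s⁻¹)
open import Data.Nat.Induction using (<-wellFounded)
open import Data.Nat.Properties
open import Data.List.Membership.DecPropositional _≟_ using (_∈?_)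
open import Data.Product using (∃; _×_; _,_; proj₂)
open import Data.Sum using (_⊎_; inj₁; inj₂; [_,_]′)
open import Function using (_∘_; Injective; id)
open import Function.Bundles using (Equivalence)
open import Induction.WellFounded using (Acc; acc)
open import Relation.Binary.Definitions using (tri<; tri≈; tri>)
open import Relation.Binary.PropositionalEquality
open import Relation.Nullary using (does; yes; no; contradiction)
open import Relation.Nullary.Decidable using (dec-true; dec-false; T?)
open import Algebra.Properties.CommutativeSemigroup
  (CommutativeMonoid.commutativeSemigroup ∧-commutativeMonoid) using (xy∙z≈xz∙y)
open import Algebra.Solver.CommutativeMonoid ∧-commutativeMonoid using (solve; _⊜_; _⊕_)

open ≡-Reasoning

covered⇒<length : ∀ l n → (∀ j → j ≤ n → j ∈ l) → n < length l
covered⇒<length l n covered = ≰⇒> λ length≤n →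
  let i , j , i<j , same = pigeonhole (s≤s length≤n) position
  in <-irrefl (trans (position-correct i) (trans (cong (lookup l) same) (sym (position-correct j)))) i<j
  where
  position : Fin (suc n) → Fin (length l)
  position j = index (covered (toℕ j) (toℕ≤pred[n] j))
  position-correct : ∀ j → toℕ j ≡ lookup l (position j)
  position-correct j = lookup-index (covered (toℕ j) (toℕ≤pred[n] j))

mexAux-below : ∀ f m l → (∀ j → j < m → j ∈ l) → ∀ j → j < mexAux f m l → j ∈ l
mexAux-below zero m l below = below
mexAux-below (suc f) m l below with m ∈? l
... | no _ = below
... | yes m∈l = mexAux-below f (suc m) l below′
  where
  below′ : ∀ j → j < suc m → j ∈ l
  below′ j j<1+m with m≤n⇒m<n∨m≡n (s≤s⁻¹ j<1+m)
  ... | inj₁ j<m = below j j<m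
  ... | inj₂ refl = m∈l

mexAux-∉ : ∀ f m l → mexAux f m l ∉ l ⊎ mexAux f m l ≡ m + f
mexAux-∉ zero m l = inj₂ (sym (+-identityʳ m))
mexAux-∉ (suc f) m l with m ∈? l
... | no m∉l = inj₁ m∉l
... | yes _ with mexAux-∉ f (suc m) l
...   | inj₁ ∉l = inj₁ ∉l
...   | inj₂ eq = inj₂ (trans eq (sym (+-suc m f)))

mex-minimal : ∀ l {j} → j < mex l → j ∈ l
mex-minimal l {j} = mexAux-below (length l) 0 l (λ _ ()) j

mex∉ : ∀ l → mex l ∉ l
mex∉ l with mexAux-∉ (length l) 0 l
... | inj₁ ∉l = ∉l
... | inj₂ mex≡length = λ mex∈l → <-irrefl refl (covered⇒<length l (length l) (covered mex∈l))
  where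
  covered : mex l ∈ l → ∀ j → j ≤ length l → j ∈ l
  covered mex∈l j j≤length with m≤n⇒m<n∨m≡n j≤length
  ... | inj₁ j<length = mex-minimal l (subst (j <_) (sym mex≡length) j<length)
  ... | inj₂ refl = subst (_∈ l) mex≡length mex∈l

mex-superset : ∀ {l l′} → l ⊆ l′ → (∀ {y} → y ∈ l′ → y ∈ l ⊎ y ≢ mex l) → mex l′ ≡ mex l
mex-superset {l} {l′} l⊆l′ new with <-cmp (mex l′) (mex l)
... | tri< lt _ _ = contradiction (l⊆l′ (mex-minimal l lt)) (mex∉ l′)
... | tri≈ _ eq _ = eq
... | tri> _ _ gt = ⊥-elim ([ mex∉ l , (λ mex≢mex → mex≢mex refl) ]′ (new (mex-minimal l′ gt)))

mex-cong : ∀ {l l′} → l ⊆ l′ → l′ ⊆ l → mex l ≡ mex l′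
mex-cong l⊆l′ l′⊆l = sym (mex-superset l⊆l′ (inj₁ ∘ l′⊆l))

filterB≡filterᵇ : ∀ {A : Set} (p : A → Bool) xs → filterB p xs ≡ filterᵇ p xs
filterB≡filterᵇ p [] = refl
filterB≡filterᵇ p (x ∷ xs) with p x
... | true = cong (x ∷_) (filterB≡filterᵇ p xs)
... | false = filterB≡filterᵇ p xs

filterB-∧ : ∀ {A : Set} (p q : A → Bool) xs → filterB (λ x → p x ∧ q x) xs ≡ filterB q (filterB p xs)
filterB-∧ p q [] = refl
filterB-∧ p q (x ∷ xs) with p x
... | false = filterB-∧ p q xs
... | true with q x
...   | true = cong (x ∷_) (filterB-∧ p q xs)
...   | false = filterB-∧ p q xs

module _ {N : ℕ} where

  -- The vertex test of deleteN, so that S ∖ x and deleteN G S v are both of the form λ y → S y ∧ m y.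
  _==_ : Fin N → Fin N → Bool
  u == v = does (toℕ u ≟ toℕ v)

  ==-refl : ∀ v → (v == v) ≡ true
  ==-refl v = dec-true (toℕ v ≟ toℕ v) refl

  ==-≢ : ∀ {u v} → u ≢ v → (u == v) ≡ false
  ==-≢ u≢v = dec-false (toℕ _ ≟ toℕ _) (u≢v ∘ toℕ-injective)

  infixl 5 _∖_
  _∖_ : VSet N → Fin N → VSet N
  (S ∖ x) y = S y ∧ not (y == x)

  full : VSet N
  full _ = true

  size : VSet N → ℕ
  size S = length (members S)

  members≡filterᵇ : ∀ S → members S ≡ filterᵇ S (allFin N)
  members≡filterᵇ S = filterB≡filterᵇ S (allFin N)

  ∈-members : ∀ {S v} → S v ≡ true → v ∈ members S
  ∈-members {S} {v} sv = subst (v ∈_) (sym (members≡filterᵇ S))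
    (∈-filter⁺ (T? ∘ S) (∈-allFin v) (Equivalence.from T-≡ sv))

  members-∈ : ∀ {S v} → v ∈ members S → S v ≡ true
  members-∈ {S} {v} v∈S = Equivalence.to T-≡
    (proj₂ (∈-filter⁻ (T? ∘ S) {xs = allFin N} (subst (v ∈_) (members≡filterᵇ S) v∈S)))

  size≤ : ∀ S → size S ≤ N
  size≤ S rewrite members≡filterᵇ S =
    ≤-trans (length-filter (T? ∘ S) (allFin N)) (≤-reflexive (length-tabulate id))

  size-∧< : ∀ S m {v} → S v ≡ true → m v ≡ false → size (λ y → S y ∧ m y) < size S
  size-∧< S m {v} sv mv rewrite filterB-∧ S m (allFin N) | filterB≡filterᵇ m (members S) =
    filter-notAll (T? ∘ m) (members S) (lose (∈-members sv) (subst T mv))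

  ∖-comm : ∀ S u w → S ∖ u ∖ w ≗ S ∖ w ∖ u
  ∖-comm S u w y = xy∙z≈xz∙y (S y) _ _

  ∖-cong : ∀ {S T x} → S ≗ T → S ∖ x ≗ T ∖ x
  ∖-cong S≗T y = cong (_∧ _) (S≗T y)

  ∖⁺ : ∀ {S x y} → S y ≡ true → y ≢ x → (S ∖ x) y ≡ true
  ∖⁺ sy y≢x rewrite sy | ==-≢ y≢x = refl

  ∖⁻ : ∀ {S x y} → (S ∖ x) y ≡ true → S y ≡ true × y ≢ x
  ∖⁻ {S} {x} {y} sy = ∧-conicalˡ _ _ sy , y≢x
    where
    y≢x : y ≢ x
    y≢x refl with () ← trans (cong not (sym (==-refl y))) (∧-conicalʳ (S y) _ sy)

module _ {N : ℕ} (G : Graph N) where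

  deleteN⁺ : ∀ {S v y} → S y ≡ true → y ≢ v → G v y ≡ false → deleteN G S v y ≡ true
  deleteN⁺ sy y≢v ¬vy rewrite sy | ==-≢ y≢v | ¬vy = refl

  deleteN-⊆ : ∀ {S v y} → deleteN G S v y ≡ true → S y ≡ true
  deleteN-⊆ = ∧-conicalˡ _ _

  deleteN-neighbour : ∀ {S v y} → G v y ≡ true → deleteN G S v y ≡ false
  deleteN-neighbour {S} {y = y} vy rewrite vy = trans (cong (S y ∧_) (∧-zeroʳ _)) (∧-zeroʳ _)

  deleteN-cong : ∀ {S T v} → S ≗ T → deleteN G S v ≗ deleteN G T v
  deleteN-cong S≗T y = cong (_∧ _) (S≗T y)

  deleteN-∖-comm : ∀ S {u v} → deleteN G (S ∖ u) v ≗ deleteN G S v ∖ u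
  deleteN-∖-comm S y = xy∙z≈xz∙y (S y) _ _

  deleteN-∖∖-comm : ∀ S {u w v} → deleteN G (S ∖ u ∖ w) v ≗ deleteN G S v ∖ u ∖ w
  deleteN-∖∖-comm S y = trans (deleteN-∖-comm (S ∖ _) y) (∖-cong (deleteN-∖-comm S) y)

  deleteN-∖-neighbour : ∀ {S v x} → G v x ≡ true → deleteN G (S ∖ x) v ≗ deleteN G S v
  deleteN-∖-neighbour {S} {x = x} vx y with y ≟ᶠ x
  ... | yes refl = trans (deleteN-neighbour {S ∖ y} vx) (sym (deleteN-neighbour {S} vx))
  ... | no y≢x rewrite ==-≢ y≢x = cong (_∧ _) (∧-identityʳ (S y))

  Isolated : VSet N → Fin N → Set
  Isolated S u = S u ≡ true × (∀ {y} → S y ≡ true → G u y ≡ false)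

  Pendant : Fin N → Fin N → Set
  Pendant c ℓ = ∀ y → G ℓ y ≡ (y == c)

  deleteN-isolated : ∀ {S u} → Isolated S u → deleteN G S u ≗ S ∖ u
  deleteN-isolated {S} (_ , isolated) y with S y in sy
  ... | true rewrite isolated sy = ∧-identityʳ _
  ... | false = refl

  isolated-∖ : ∀ {S u x} → Isolated S u → u ≢ x → Isolated (S ∖ x) u
  isolated-∖ {S} (su , isolated) u≢x = ∖⁺ {S = S} su u≢x , isolated ∘ ∧-conicalˡ _ _

  𝒢 : VSet N → ℕ
  𝒢 = grundyF G N

  options : VSet N → List ℕ
  options S = map (λ v → 𝒢 (deleteN G S v)) (members S)

  size-deleteN< : ∀ {S v} → S v ≡ true → size (deleteN G S v) < size S
  size-deleteN< {S} {v} sv = size-∧< S _ sv (cong (λ b → not b ∧ not (G v v)) (==-refl v))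

  grundyF-fuel : ∀ f g S → size S ≤ f → size S ≤ g → grundyF G f S ≡ grundyF G g S
  grundyF-fuel zero zero S _ _ = refl
  grundyF-fuel zero (suc g) S size≤0 _ = sym (mex-no-moves (members S) size≤0)
    where
    mex-no-moves : ∀ vs → length vs ≤ 0 → mex (map (λ v → grundyF G g (deleteN G S v)) vs) ≡ 0
    mex-no-moves [] _ = refl
  grundyF-fuel (suc f) zero S size≤1+f size≤0 = sym (grundyF-fuel zero (suc f) S size≤0 size≤1+f)
  grundyF-fuel (suc f) (suc g) S size≤1+f size≤1+g =
    cong mex (map-cong-local {xs = members S} (All.tabulate λ v∈S →
      let smaller = size-deleteN< (members-∈ v∈S) in
      grundyF-fuel f g _ (s≤s⁻¹ (≤-trans smaller size≤1+f)) (s≤s⁻¹ (≤-trans smaller size≤1+g))))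

  𝒢-unfold : ∀ S → 𝒢 S ≡ mex (options S)
  𝒢-unfold S = grundyF-fuel N (suc N) S (size≤ S) (m≤n⇒m≤1+n (size≤ S))

  option⁺ : ∀ {S v} → S v ≡ true → 𝒢 (deleteN G S v) ∈ options S
  option⁺ sv = ∈-map⁺ _ (∈-members sv)

  option⁻ : ∀ {S y} → y ∈ options S → ∃ λ v → S v ≡ true × y ≡ 𝒢 (deleteN G S v)
  option⁻ y∈ with ∈-map⁻ _ y∈
  ... | v , v∈S , refl = v , members-∈ v∈S , refl

  𝒢-option-≢ : ∀ {S v} → S v ≡ true → 𝒢 (deleteN G S v) ≢ 𝒢 S
  𝒢-option-≢ {S} sv eq = mex∉ (options S) (subst (_∈ options S) (trans eq (𝒢-unfold S)) (option⁺ sv))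

module _ {M N : ℕ} {H : Graph M} {G : Graph N} {e : Fin M → Fin N}
         (e-injective : Injective _≡_ _≡_ e) (e-adjacent : ∀ a b → H a b ≡ G (e a) (e b)) where

  ==-embedding : ∀ a b → (a == b) ≡ (e a == e b)
  ==-embedding a b with a ≟ᶠ b
  ... | yes refl = trans (==-refl a) (sym (==-refl (e a)))
  ... | no a≢b = trans (==-≢ a≢b) (sym (==-≢ (a≢b ∘ e-injective)))

  𝒢-embedding : ∀ {S T} → (∀ a → S a ≡ T (e a)) → (∀ y → T y ≡ true → ∃ λ a → e a ≡ y) → 𝒢 H S ≡ 𝒢 G T
  𝒢-embedding {S} = go (<-wellFounded (size S))
    where
    go : ∀ {S T} → Acc _<_ (size S) → (∀ a → S a ≡ T (e a)) → (∀ y → T y ≡ true → ∃ λ a → e a ≡ y) →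
         𝒢 H S ≡ 𝒢 G T
    go {S} {T} (acc rec) S≡T∘e onto = begin
      𝒢 H S              ≡⟨ 𝒢-unfold H S ⟩
      mex (options H S)  ≡⟨ mex-cong optionsH⊆ optionsG⊆ ⟩
      mex (options G T)  ≡⟨ 𝒢-unfold G T ⟨
      𝒢 G T              ∎
      where
      move : ∀ {a} → S a ≡ true → 𝒢 H (deleteN H S a) ≡ 𝒢 G (deleteN G T (e a))
      move {a} sa = go (rec (size-deleteN< H sa))
        (λ b → cong₂ _∧_ (S≡T∘e b) (cong₂ (λ p q → not p ∧ not q) (==-embedding b a) (e-adjacent a b)))
        (λ y → onto y ∘ deleteN-⊆ G {T})
      optionsH⊆ : options H S ⊆ options G T
      optionsH⊆ y∈ with option⁻ H y∈
      ... | a , sa , refl = subst (_∈ options G T) (sym (move sa)) (option⁺ G (trans (sym (S≡T∘e a)) sa))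
      optionsG⊆ : options G T ⊆ options H S
      optionsG⊆ y∈ with option⁻ G y∈
      ... | v , tv , refl with onto v tv
      ... | a , refl = subst (_∈ options H S) (move (trans (S≡T∘e a) tv)) (option⁺ H (trans (S≡T∘e a) tv))

𝒢-cong : ∀ {N} (G : Graph N) {S T} → S ≗ T → 𝒢 G S ≡ 𝒢 G T
𝒢-cong G S≗T = 𝒢-embedding id (λ _ _ → refl) S≗T (λ y _ → y , refl)

module _ {N : ℕ} (G : Graph N) where

  𝒢-∖-isolated-≢ : ∀ {S u} → Isolated G S u → 𝒢 G (S ∖ u) ≢ 𝒢 G S
  𝒢-∖-isolated-≢ iu@(su , _) = 𝒢-option-≢ G su ∘ trans (𝒢-cong G (deleteN-isolated G iu))

  options-∖∖-⊆ : ∀ {S u w} →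
    (∀ {v} → S v ≡ true → v ≢ u → v ≢ w → 𝒢 G (deleteN G S v) ≡ 𝒢 G (deleteN G (S ∖ u ∖ w) v)) →
    options G (S ∖ u ∖ w) ⊆ options G S
  options-∖∖-⊆ {S} {u} same y∈ with option⁻ G y∈
  ... | v , s′v , refl with ∖⁻ {S = S ∖ u} s′v
  ... | s₁v , v≢w with ∖⁻ {S = S} s₁v
  ... | sv , v≢u = subst (_∈ options G S) (same sv v≢u v≢w) (option⁺ G sv)

module SimpleGraph {N : ℕ} {G : Graph N}
  (G-sym : ∀ u v → G u v ≡ G v u) (G-irrefl : ∀ v → G v v ≡ false) where

  isolated-deleteN : ∀ {S u v} → Isolated G S u → S v ≡ true → u ≢ v → Isolated G (deleteN G S v) u
  isolated-deleteN {S} (su , isolated) sv u≢v =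
    deleteN⁺ G {S} su u≢v (trans (G-sym _ _) (isolated sv)) , isolated ∘ deleteN-⊆ G {S}

  𝒢-∖-isolated-pair : ∀ {S u w} → Isolated G S u → Isolated G S w → u ≢ w → 𝒢 G S ≡ 𝒢 G (S ∖ u ∖ w)
  𝒢-∖-isolated-pair {S} = go (<-wellFounded (size S))
    where
    go : ∀ {S u w} → Acc _<_ (size S) → Isolated G S u → Isolated G S w → u ≢ w →
         𝒢 G S ≡ 𝒢 G (S ∖ u ∖ w)
    go {S} {u} {w} (acc rec) iu iw u≢w = begin
      𝒢 G S                ≡⟨ 𝒢-unfold G S ⟩
      mex (options G S)    ≡⟨ mex-superset (options-∖∖-⊆ G otherMove) newOption ⟩
      mex (options G S′)   ≡⟨ 𝒢-unfold G S′ ⟨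
      𝒢 G S′               ∎
      where
      S′ = S ∖ u ∖ w
      otherMove : ∀ {v} → S v ≡ true → v ≢ u → v ≢ w → 𝒢 G (deleteN G S v) ≡ 𝒢 G (deleteN G S′ v)
      otherMove sv v≢u v≢w = begin
        𝒢 G (deleteN G S _)
          ≡⟨ go (rec (size-deleteN< G sv))
                (isolated-deleteN iu sv (v≢u ∘ sym)) (isolated-deleteN iw sv (v≢w ∘ sym)) u≢w ⟩
        𝒢 G (deleteN G S _ ∖ u ∖ w)  ≡⟨ 𝒢-cong G (deleteN-∖∖-comm G S) ⟨
        𝒢 G (deleteN G S′ _)         ∎
      -- S′ is reached from S ∖ p by playing q, so 𝒢 (S ∖ p) ≠ 𝒢 S′.
      isolatedMove : ∀ {p q} → Isolated G S p → Isolated G S q → p ≢ q → S ∖ p ∖ q ≗ S′ →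
                     𝒢 G (deleteN G S p) ≢ mex (options G S′)
      isolatedMove ip iq p≢q S∖p∖q≗S′ eq = 𝒢-∖-isolated-≢ G (isolated-∖ G iq (p≢q ∘ sym)) (begin
        𝒢 G (_ ∖ _ ∖ _)      ≡⟨ 𝒢-cong G S∖p∖q≗S′ ⟩
        𝒢 G S′               ≡⟨ 𝒢-unfold G S′ ⟩
        mex (options G S′)   ≡⟨ eq ⟨
        𝒢 G (deleteN G S _)  ≡⟨ 𝒢-cong G (deleteN-isolated G ip) ⟩
        𝒢 G (S ∖ _)          ∎)
      newOption : ∀ {y} → y ∈ options G S → y ∈ options G S′ ⊎ y ≢ mex (options G S′)
      newOption y∈ with option⁻ G y∈
      ... | v , sv , refl with v ≟ᶠ u | v ≟ᶠ w
      ... | yes refl | _ = inj₂ (isolatedMove iu iw u≢w (λ _ → refl))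
      ... | no _ | yes refl = inj₂ (isolatedMove iw iu (u≢w ∘ sym) (∖-comm S w u))
      ... | no v≢u | no v≢w = inj₁ (subst (_∈ options G S′) (sym (otherMove sv v≢u v≢w))
                                        (option⁺ G (∖⁺ {S = S ∖ u} (∖⁺ {S = S} sv v≢u) v≢w)))

  pendant-≢ : ∀ {c ℓ} → Pendant G c ℓ → ℓ ≢ c
  pendant-≢ {c} pℓ refl with () ← trans (sym (G-irrefl c)) (trans (pℓ c) (==-refl c))

  leaf-centre : ∀ {c ℓ} → Pendant G c ℓ → G ℓ c ≡ true
  leaf-centre {c} pℓ = trans (pℓ c) (==-refl c)

  centre-leaf : ∀ {c ℓ} → Pendant G c ℓ → G c ℓ ≡ true
  centre-leaf pℓ = trans (G-sym _ _) (leaf-centre pℓ)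

  noncentre-leaf : ∀ {c ℓ v} → Pendant G c ℓ → v ≢ c → G v ℓ ≡ false
  noncentre-leaf pℓ v≢c = trans (G-sym _ _) (trans (pℓ _) (==-≢ v≢c))

  pendant-isolated : ∀ {S c ℓ} → Pendant G c ℓ → S ℓ ≡ true → S c ≡ false → Isolated G S ℓ
  pendant-isolated {S} {c} pℓ sℓ sc = sℓ , λ {y} sy → trans (pℓ y) (==-≢ (y≢c sy))
    where
    y≢c : ∀ {y} → S y ≡ true → y ≢ c
    y≢c sy refl with () ← trans (sym sc) sy

  -- Both sides are S with p, q, x and the centre c removed.
  deleteN-pendant-swap : ∀ {S c p q x} → Pendant G c p → Pendant G c x →
                         deleteN G S p ∖ q ∖ x ≗ deleteN G (S ∖ p ∖ q) x
  deleteN-pendant-swap {S} {c} {p} {q} {x} pp px y rewrite pp y | px y =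
    solve 5 (λ s p̸ c̸ q̸ x̸ → ((s ⊕ (p̸ ⊕ c̸)) ⊕ q̸) ⊕ x̸ ⊜ ((s ⊕ p̸) ⊕ q̸) ⊕ (x̸ ⊕ c̸)) refl
      (S y) (not (y == p)) (not (y == c)) (not (y == q)) (not (y == x))

  -- Playing p deletes the centre, after which q and x are isolated and cancel.
  𝒢-pendant-move : ∀ {S c p q x} → Pendant G c p → Pendant G c q → Pendant G c x → p ≢ q → p ≢ x → q ≢ x →
                S q ≡ true → S x ≡ true → 𝒢 G (deleteN G S p) ≡ 𝒢 G (deleteN G (S ∖ p ∖ q) x)
  𝒢-pendant-move {S} {c} {p} {q} {x} pp pq px p≢q p≢x q≢x sq sx = begin
    𝒢 G (deleteN G S p)
      ≡⟨ 𝒢-∖-isolated-pair (survivor pq sq (p≢q ∘ sym)) (survivor px sx (p≢x ∘ sym)) q≢x ⟩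
    𝒢 G (deleteN G S p ∖ q ∖ x)
      ≡⟨ 𝒢-cong G (deleteN-pendant-swap {S} pp px) ⟩
    𝒢 G (deleteN G (S ∖ p ∖ q) x)  ∎
    where
    survivor : ∀ {ℓ} → Pendant G c ℓ → S ℓ ≡ true → ℓ ≢ p → Isolated G (deleteN G S p) ℓ
    survivor pℓ sℓ ℓ≢p = pendant-isolated pℓ
      (deleteN⁺ G {S} sℓ ℓ≢p (trans (pp _) (==-≢ (pendant-≢ pℓ))))
      (deleteN-neighbour G {S} (leaf-centre pp))

  𝒢-∖-pendant-twins : ∀ {c u w x} → Pendant G c u → Pendant G c w → Pendant G c x → u ≢ w → u ≢ x → w ≢ x →
    ∀ {S} → S u ≡ true → S w ≡ true → (S c ≡ true → S x ≡ true) → 𝒢 G S ≡ 𝒢 G (S ∖ u ∖ w)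
  𝒢-∖-pendant-twins {c} {u} {w} {x} pu pw px u≢w u≢x w≢x {S} = go (<-wellFounded (size S))
    where
    go : ∀ {S} → Acc _<_ (size S) → S u ≡ true → S w ≡ true → (S c ≡ true → S x ≡ true) →
         𝒢 G S ≡ 𝒢 G (S ∖ u ∖ w)
    go {S} (acc rec) su sw c⇒x with S c in sc
    ... | false = 𝒢-∖-isolated-pair (pendant-isolated pu su sc) (pendant-isolated pw sw sc) u≢w
    ... | true = begin
      𝒢 G S               ≡⟨ 𝒢-unfold G S ⟩
      mex (options G S)   ≡⟨ mex-cong toS′ (options-∖∖-⊆ G otherMove) ⟩
      mex (options G S′)  ≡⟨ 𝒢-unfold G S′ ⟨
      𝒢 G S′              ∎
      where
      S′ = S ∖ u ∖ w
      sx = c⇒x refl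
      s′x : S′ x ≡ true
      s′x = ∖⁺ {S = S ∖ u} (∖⁺ {S = S} sx (u≢x ∘ sym)) (w≢x ∘ sym)
      otherMove : ∀ {v} → S v ≡ true → v ≢ u → v ≢ w → 𝒢 G (deleteN G S v) ≡ 𝒢 G (deleteN G S′ v)
      otherMove {v} sv v≢u v≢w with v ≟ᶠ c
      ... | yes refl = 𝒢-cong G λ y → sym (trans (deleteN-∖-neighbour G {S ∖ u} (centre-leaf pw) y)
                                                 (deleteN-∖-neighbour G {S} (centre-leaf pu) y))
      ... | no v≢c = begin
        𝒢 G (deleteN G S v)
          ≡⟨ go (rec (size-deleteN< G sv)) (survivor su pu v≢u) (survivor sw pw v≢w) c⇒x′ ⟩
        𝒢 G (deleteN G S v ∖ u ∖ w)    ≡⟨ 𝒢-cong G (deleteN-∖∖-comm G S) ⟨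
        𝒢 G (deleteN G S′ v)           ∎
        where
        survivor : ∀ {ℓ} → S ℓ ≡ true → Pendant G c ℓ → v ≢ ℓ → deleteN G S v ℓ ≡ true
        survivor sℓ pℓ v≢ℓ = deleteN⁺ G {S} sℓ (v≢ℓ ∘ sym) (noncentre-leaf pℓ v≢c)
        c⇒x′ : deleteN G S v c ≡ true → deleteN G S v x ≡ true
        c⇒x′ dc = survivor sx px v≢x
          where
          v≢x : v ≢ x
          v≢x refl with () ← trans (sym dc) (deleteN-neighbour G {S} (leaf-centre px))
      toS′ : options G S ⊆ options G S′
      toS′ y∈ with option⁻ G y∈
      ... | v , sv , refl with v ≟ᶠ u | v ≟ᶠ w
      ... | yes refl | _ = subst (_∈ options G S′)
            (sym (𝒢-pendant-move pu pw px u≢w u≢x w≢x sw sx))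
            (option⁺ G s′x)
      ... | no _ | yes refl = subst (_∈ options G S′)
            (sym (trans (𝒢-pendant-move pw pu px (u≢w ∘ sym) w≢x u≢x su sx)
                        (𝒢-cong G (deleteN-cong G (∖-comm S w u)))))
            (option⁺ G s′x)
      ... | no v≢u | no v≢w = subst (_∈ options G S′) (sym (otherMove sv v≢u v≢w))
                                (option⁺ G (∖⁺ {S = S ∖ u} (∖⁺ {S = S} sv v≢u) v≢w))

dirEdge-irrefl : ∀ n a → dirEdge n a a ≡ false
dirEdge-irrefl n zero = refl
dirEdge-irrefl n (suc a) rewrite dec-false (a ≟ suc a) (1+n≢n ∘ sym) = ∧-zeroʳ _

n<ᵇ1+m≡false : ∀ {m n} → m < n → (n <ᵇ suc m) ≡ false
n<ᵇ1+m≡false {m} {n} m<n = dec-false (n <? suc m) (<⇒≱ m<n ∘ s≤s⁻¹)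

dirEdge-leaf : ∀ {n a} b → a < n → dirEdge n (suc a) b ∨ dirEdge n b (suc a) ≡ (b ≡ᵇ 0)
dirEdge-leaf {n} {a} zero a<n rewrite n<ᵇ1+m≡false a<n | dec-true (a <? suc n) (m≤n⇒m≤1+n a<n) = refl
dirEdge-leaf {a = a} (suc b) a<n rewrite n<ᵇ1+m≡false a<n with a ≟ suc b
... | no a≢1+b rewrite dec-false (a ≟ suc b) a≢1+b = ∧-zeroʳ _
... | yes refl rewrite n<ᵇ1+m≡false (<-trans (n<1+n b) a<n) = refl

starPath-sym : ∀ n k u v → starPath n k u v ≡ starPath n k v u
starPath-sym n k u v = ∨-comm (dirEdge n (toℕ u) (toℕ v)) _

starPath-irrefl : ∀ n k v → starPath n k v v ≡ false
starPath-irrefl n k v rewrite dirEdge-irrefl n (toℕ v) = refl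

starPath-leaf : ∀ {n k} (i : Fin (n + k)) → toℕ i < n → Pendant (starPath n k) zero (suc i)
starPath-leaf i i<n y = dirEdge-leaf (toℕ y) i<n

-- Vertex 0 is the centre and 1, …, n are the leaves, so this embedding misses exactly leaves 1 and 2.
skipLeaves₁₂ : ∀ {m} → Fin (suc m) → Fin (3 + m)
skipLeaves₁₂ zero = zero
skipLeaves₁₂ (suc i) = suc (suc (suc i))

skipLeaves₁₂-injective : ∀ {m} → Injective _≡_ _≡_ (skipLeaves₁₂ {m})
skipLeaves₁₂-injective {x = zero} {zero} _ = refl
skipLeaves₁₂-injective {x = suc i} {suc .i} refl = refl

starPath-skipLeaves₁₂ : ∀ n k a b → starPath n k a b ≡ starPath (2 + n) k (skipLeaves₁₂ a) (skipLeaves₁₂ b)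
starPath-skipLeaves₁₂ n k zero zero = refl
starPath-skipLeaves₁₂ n k zero (suc b) = refl
starPath-skipLeaves₁₂ n k (suc a) zero = refl
starPath-skipLeaves₁₂ n k (suc a) (suc b) = refl

withoutLeaves₁₂ : ∀ {m} → VSet (3 + m)
withoutLeaves₁₂ = full ∖ suc zero ∖ suc (suc zero)

skipLeaves₁₂-image : ∀ {m} (a : Fin (suc m)) → full a ≡ withoutLeaves₁₂ (skipLeaves₁₂ a)
skipLeaves₁₂-image zero = refl
skipLeaves₁₂-image (suc a) = refl

skipLeaves₁₂-onto : ∀ {m} (y : Fin (3 + m)) → withoutLeaves₁₂ y ≡ true → ∃ λ a → skipLeaves₁₂ a ≡ y
skipLeaves₁₂-onto zero _ = zero , refl
skipLeaves₁₂-onto (suc (suc (suc i))) _ = suc i , refl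

mainTheorem4 : (k n : ℕ) → 1 ≤ k → 3 ≤ n →
    grundy (starPath n k) ≡ grundy (starPath (n ∸ 2) k)
mainTheorem4 k (suc zero) _ (s≤s ())
mainTheorem4 k (suc (suc zero)) _ (s≤s (s≤s ()))
mainTheorem4 k (suc (suc (suc m))) _ _ = begin
  𝒢 G full
    ≡⟨ 𝒢-∖-pendant-twins {zero} {u} {w} {x} (leaf zero (s≤s z≤n)) (leaf (suc zero) (s≤s (s≤s z≤n)))
         (leaf (suc (suc zero)) (s≤s (s≤s (s≤s z≤n)))) (λ ()) (λ ()) (λ ()) {full} refl refl (λ _ → refl) ⟩
  𝒢 G withoutLeaves₁₂
    ≡⟨ 𝒢-embedding {G = G} skipLeaves₁₂-injective (starPath-skipLeaves₁₂ (suc m) k)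
         skipLeaves₁₂-image skipLeaves₁₂-onto ⟨
  𝒢 (starPath (suc m) k) full
    ∎
  where
  G = starPath (3 + m) k
  open SimpleGraph (starPath-sym (3 + m) k) (starPath-irrefl (3 + m) k)
  leaf : ∀ i → toℕ i < 3 + m → Pendant G zero (suc i)
  leaf = starPath-leaf
  u w x : Fin (4 + m + k)
  u = suc zero
  w = suc (suc zero)
  x = suc (suc (suc zero))
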